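{- Let $t\ge s\ge 2$ be integers, let $G$ be an $H_{s,t}$-free bipartite graph with bipartition $(A,B)$, and let $M$ be an $(s-1)$-matching in $G$. Then the number of $s$-matchings $L$ in $N(M)$ such that $(M,L)$ is $2t$-correlated is at most $(s-1)(t-1)\cdot e(N(M))^{s-1}\, v(N(M))$.
   Context: For integers $t\ge s\ge 2$, $H_{s,t}$ is obtained from an $s$-matching $a_1b_1,\dots,a_sb_s$ and a vertex-disjoint $t$-matching $c_1d_1,\dots,c_td_t$ by adding all edges $a_id_j$ and $b_ic_j$ ($i\in[s]$, $j\in[t]$). For $S\subseteq V(G)$, $N_G(S)=\bigcap_{v\in S}N_G(v)$ is the common neighbourhood of $S$. For a matching $M$ in $G$, let $A_M=V(M)\cap A$ and $B_M=V(M)\cap B$; the neighbourhood graph $N(M)$ is the subgraph of $G$ induced by the vertex set $(N_G(B_M)\setminus V(M))\cup(N_G(A_M)\setminus V(M))$. $e(\cdot)$ and $v(\cdot)$ denote the numbers of edges and vertices. For matchings $M,L$ in $G$, write $M\sim L$ if $L$ is a subgraph of $N(M)$. For a nonnegative integer $t'$, an ordered pair $(M,L)$ of matchings is $t'$-correlated if $M\sim L$ and there is a vertex $v\in V(M)$ with $d_{N(L)}(v)\ge t'$ (degree of $v$ in the graph $N(L)$). -}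

module Defs where

open import Data.Nat using (ℕ; zero; suc; _+_; _<ᵇ_; _≤ᵇ_)
open import Data.Fin using (Fin; zero; suc; toℕ)
open import Data.Fin.Properties using () renaming (_≟_ to _≟F_)
open import Data.Bool using (Bool; true; false; _∧_; _∨_; not; if_then_else_)
open import Data.Product using (_×_; _,_; proj₁; proj₂; Σ)
open import Data.Sum using (_⊎_; inj₁; inj₂)
open import Data.Vec.Functional using (_∷_)
open import Relation.Nullary using (¬_; does)
open import Relation.Binary.PropositionalEquality using (_≡_)

allF : (n : ℕ) → (Fin n → Bool) → Bool
allF zero    P = true
allF (suc n) P = P zero ∧ allF n (λ i → P (suc i))

anyF : (n : ℕ) → (Fin n → Bool) → Bool
anyF zero    P = false
anyF (suc n) P = P zero ∨ anyF n (λ i → P (suc i))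

sumF : (n : ℕ) → (Fin n → ℕ) → ℕ
sumF zero    f = 0
sumF (suc n) f = f zero + sumF n (λ i → f (suc i))

countF : (n : ℕ) → (Fin n → Bool) → ℕ
countF n P = sumF n (λ i → if P i then 1 else 0)

-- A finite bipartite graph G with bipartition (A,B), A = Fin p, B = Fin q,
-- given by its bipartite adjacency  E a b = true  iff  ab ∈ E(G).

BipGraph : ℕ → ℕ → Set
BipGraph p q = Fin p → Fin q → Bool

V : ℕ → ℕ → Set
V p q = Fin p ⊎ Fin q

_≡ᵛ_ : ∀ {p q} → V p q → V p q → Bool
inj₁ a ≡ᵛ inj₁ a' = does (a ≟F a')
inj₂ b ≡ᵛ inj₂ b' = does (b ≟F b')
inj₁ _ ≡ᵛ inj₂ _  = false
inj₂ _ ≡ᵛ inj₁ _  = false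

adj : ∀ {p q} → BipGraph p q → V p q → V p q → Bool
adj E (inj₁ a) (inj₂ b) = E a b
adj E (inj₂ b) (inj₁ a) = E a b
adj E (inj₁ _) (inj₁ _) = false
adj E (inj₂ _) (inj₂ _) = false

countV : ∀ {p q} → (V p q → Bool) → ℕ
countV {p} {q} P = countF p (λ a → P (inj₁ a)) + countF q (λ b → P (inj₂ b))

data HV (s t : ℕ) : Set where
  a b : Fin s → HV s t
  c d : Fin t → HV s t

-- the edges of H_{s,t} (each unordered edge listed once)
data HEdge {s t : ℕ} : HV s t → HV s t → Set where
  ab : (i : Fin s) → HEdge (a i) (b i)
  cd : (j : Fin t) → HEdge (c j) (d j)
  ad : (i : Fin s) (j : Fin t) → HEdge (a i) (d j)
  bc : (i : Fin s) (j : Fin t) → HEdge (b i) (c j)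

ContainsH : ∀ {p q} → (s t : ℕ) → BipGraph p q → Set
ContainsH {p} {q} s t E =
  Σ (HV s t → V p q) λ f →
    (∀ x y → f x ≡ f y → x ≡ y) ×
    (∀ x y → HEdge x y → adj E (f x) (f y) ≡ true)

HFree : ∀ {p q} → (s t : ℕ) → BipGraph p q → Set
HFree s t E = ¬ ContainsH s t E

-- Matchings, represented as families of edges  m i = (a_i , b_i),  a_i ∈ A, b_i ∈ B

Edges : ℕ → ℕ → ℕ → Set
Edges k p q = Fin k → Fin p × Fin q

IsMatching : ∀ {k p q} → BipGraph p q → Edges k p q → Set
IsMatching {k} E m =
  (∀ i → E (proj₁ (m i)) (proj₂ (m i)) ≡ true) ×
  (∀ i j → proj₁ (m i) ≡ proj₁ (m j) → i ≡ j) ×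
  (∀ i j → proj₂ (m i) ≡ proj₂ (m j) → i ≡ j)

AM : ∀ {k p q} → Edges k p q → Fin k → V p q
AM m i = inj₁ (proj₁ (m i))

BM : ∀ {k p q} → Edges k p q → Fin k → V p q
BM m i = inj₂ (proj₂ (m i))

inVM : ∀ {k p q} → Edges k p q → V p q → Bool
inVM {k} m v = anyF k (λ i → (v ≡ᵛ AM m i) ∨ (v ≡ᵛ BM m i))

inCommonNbr : ∀ {k p q} → BipGraph p q → (Fin k → V p q) → V p q → Bool
inCommonNbr {k} E S v = allF k (λ i → adj E (S i) v)

inN : ∀ {k p q} → BipGraph p q → Edges k p q → V p q → Bool
inN E m v = (inCommonNbr E (BM m) v ∧ not (inVM m v))
          ∨ (inCommonNbr E (AM m) v ∧ not (inVM m v))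

-- e(N(M)): N(M) is the induced subgraph of G on V(N(M))
eN : ∀ {k p q} → BipGraph p q → Edges k p q → ℕ
eN {k} {p} {q} E m =
  sumF p (λ x → countF q (λ y → E x y ∧ inN E m (inj₁ x) ∧ inN E m (inj₂ y)))

vN : ∀ {k p q} → BipGraph p q → Edges k p q → ℕ
vN E m = countV (inN E m)

-- d_{N(M)}(v): degree of v in the graph N(M) (0 if v is not a vertex of N(M))
degN : ∀ {k p q} → BipGraph p q → Edges k p q → V p q → ℕ
degN E m v = if inN E m v then countV (λ u → inN E m u ∧ adj E v u) else 0

-- M ∼ L : L is a subgraph of N(M)  (L's edges are edges of G, N(M) is induced)
simB : ∀ {k l p q} → BipGraph p q → Edges k p q → Edges l p q → Bool
simB {l = l} E m L =
  allF l (λ i → E (proj₁ (L i)) (proj₂ (L i))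
              ∧ inN E m (inj₁ (proj₁ (L i))) ∧ inN E m (inj₂ (proj₂ (L i))))

correlated : ∀ {k l p q} → BipGraph p q → ℕ → Edges k p q → Edges l p q → Bool
correlated {k} E t' m L =
  simB E m L ∧
  anyF k (λ i → (t' ≤ᵇ degN E L (AM m i)) ∨ (t' ≤ᵇ degN E L (BM m i)))

-- L is a matching written in canonical form: A-endpoints strictly increasing
-- (this makes each unordered matching correspond to exactly one family L),
-- B-endpoints pairwise distinct.
canonMatchingB : ∀ {l p q} → Edges l p q → Bool
canonMatchingB {l} L =
  allF l (λ i → allF l (λ j →
    (not (toℕ i <ᵇ toℕ j) ∨ (toℕ (proj₁ (L i)) <ᵇ toℕ (proj₁ (L j))))
    ∧ (does (i ≟F j) ∨ not (does (proj₂ (L i) ≟F proj₂ (L j))))))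

countEdges : ∀ {p q} (l : ℕ) → (Edges l p q → Bool) → ℕ
countEdges zero P = if P (λ ()) then 1 else 0
countEdges {p} {q} (suc l) P =
  sumF p (λ x → sumF q (λ y → countEdges l (λ L → P ((x , y) ∷ L))))

-- number of s-matchings L in N(M) such that (M , L) is t'-correlated
-- (L in N(M) is the condition M ∼ L, which is part of correlated)
numCorrelated : ∀ {k p q} → BipGraph p q → (s t' : ℕ) → Edges k p q → ℕ
numCorrelated E s t' m =
  countEdges s (λ L → canonMatchingB L ∧ correlated E t' m L)

{-# OPTIONS --safe #-}
module Submission where

-- Write an s-matching L of N(M) as its first edge xy followed by the rest L′.  If (M , L) is
-- 2t-correlated through a vertex a_i of A_M, then for fixed L′ and y at most t − 1 vertices x
-- qualify.  Indeed, given t of them, x_1, …, x_t, take a = (a_i, A-ends of L′), b = (y, B_M),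
-- c = (x_1, …, x_t), and choose d_j greedily among the ≥ 2t ≥ t + s neighbours of a_i in
-- N(x_j y + L′), distinct and outside b: since y, the x_j and L′ lie in N(M), this is a copy
-- of H_{s,t}.  A witness in B_M is the same situation in the transposed graph.  Summing over
-- the s − 1 witnesses, over y (resp. x) in N(M) and over the e(N(M))^(s−1) families L′ of
-- edges of N(M) gives the bound.

open import Defs hiding (a; b; c; d; ab; cd; ad; bc)
import Algebra.Properties.Semiring.Sum
open import Data.Bool using (Bool; true; false; _∧_; _∨_; not; if_then_else_)
open import Data.Bool.Properties
  using (∧-conicalˡ; ∧-conicalʳ; ∧-zeroʳ; ∧-identityʳ; ∨-identityʳ; ¬-not; not-injective; T-≡)
open import Data.Fin using (Fin; zero; suc; toℕ; fromℕ<)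
open import Data.Fin.Properties as Finₚ using () renaming (_≟_ to _≟F_)
open import Data.Nat using (ℕ; zero; suc; _+_; _*_; _^_; _∸_; _≤_; _<_; z≤n; s≤s; s≤s⁻¹; _≤ᵇ_; _<ᵇ_)
open import Data.Nat.Properties
open import Data.Nat.Solver using (module +-*-Solver)
open import Data.Product using (_×_; _,_; proj₁; proj₂; ∃; swap)
open import Data.Sum using (inj₁; inj₂)
open import Data.Sum.Properties using (inj₁-injective; inj₂-injective)
open import Data.Vec.Functional using (_∷_)
open import Function using (_∘_; Injective; Equivalence)
open import Relation.Binary using (tri<; tri≈; tri>)
open import Relation.Binary.PropositionalEquality
open import Relation.Nullary using (¬_; Dec; does; yes; contradiction)
open import Relation.Nullary.Decidable using (dec-true)

module ℕ-Sum = Algebra.Properties.Semiring.Sum +-*-semiring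

𝟙 : Bool → ℕ
𝟙 b = if b then 1 else 0

𝟙≤1 : ∀ b → 𝟙 b ≤ 1
𝟙≤1 true  = ≤-refl
𝟙≤1 false = z≤n

𝟙-∨ : ∀ b c → 𝟙 (b ∨ c) ≤ 𝟙 b + 𝟙 c
𝟙-∨ true  c = s≤s z≤n
𝟙-∨ false c = ≤-refl

≤-𝟙* : ∀ b {m c} → (b ≡ false → m ≡ 0) → (b ≡ true → m ≤ c) → m ≤ 𝟙 b * c
≤-𝟙* true  _   m≤c = ≤-trans (m≤c refl) (≤-reflexive (sym (*-identityˡ _)))
≤-𝟙* false m≡0 _   = ≤-reflexive (m≡0 refl)

if-then-0-≤ : ∀ b m → (if b then m else 0) ≤ m
if-then-0-≤ true  m = ≤-refl
if-then-0-≤ false m = z≤n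

does-true⇒ : ∀ {A : Set} (a? : Dec A) → does a? ≡ true → A
does-true⇒ (yes a) _ = a

does-false⇒ : ∀ {A : Set} (a? : Dec A) → does a? ≡ false → ¬ A
does-false⇒ a? does≡false a = contradiction (trans (sym (dec-true a? a)) does≡false) λ ()

∨-resolveˡ : ∀ {b c} → not b ∨ c ≡ true → b ≡ true → c ≡ true
∨-resolveˡ h refl = h

∨-resolveʳ : ∀ {b c} → b ∨ not c ≡ true → c ≡ true → b ≡ true
∨-resolveʳ {b} h refl = trans (sym (∨-identityʳ b)) h

allF-true : ∀ n {P : Fin n → Bool} → allF n P ≡ true → ∀ i → P i ≡ true
allF-true (suc n) {P} h zero    = ∧-conicalˡ _ _ h
allF-true (suc n) {P} h (suc i) = allF-true n (∧-conicalʳ (P zero) _ h) i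

anyF-false : ∀ n {P : Fin n → Bool} → anyF n P ≡ false → ∀ i → P i ≡ false
anyF-false (suc n) {P} h i with P zero in P₀
anyF-false (suc n)     h zero    | false = P₀
anyF-false (suc n)     h (suc i) | false = anyF-false n h i

∷-injective : ∀ {n} {A : Set} {x : A} {f : Fin n → A} → (∀ i → x ≢ f i) → Injective _≡_ _≡_ f →
              Injective _≡_ _≡_ (x ∷ f)
∷-injective x∉f f-inj {zero}  {zero}  _ = refl
∷-injective x∉f f-inj {zero}  {suc j} e = contradiction e (x∉f j)
∷-injective x∉f f-inj {suc i} {zero}  e = contradiction (sym e) (x∉f i)
∷-injective x∉f f-inj {suc i} {suc j} e = cong suc (f-inj e)

sumF≡sum : ∀ n (f : Fin n → ℕ) → sumF n f ≡ ℕ-Sum.sum f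
sumF≡sum zero    f = refl
sumF≡sum (suc n) f = cong (f zero +_) (sumF≡sum n (f ∘ suc))

sumF-cong : ∀ n {f g : Fin n → ℕ} → (∀ i → f i ≡ g i) → sumF n f ≡ sumF n g
sumF-cong zero    f≗g = refl
sumF-cong (suc n) f≗g = cong₂ _+_ (f≗g zero) (sumF-cong n (f≗g ∘ suc))

sumF-mono : ∀ n {f g : Fin n → ℕ} → (∀ i → f i ≤ g i) → sumF n f ≤ sumF n g
sumF-mono zero    f≤g = z≤n
sumF-mono (suc n) f≤g = +-mono-≤ (f≤g zero) (sumF-mono n (f≤g ∘ suc))

sumF-const : ∀ n c → sumF n (λ _ → c) ≡ n * c
sumF-const zero    c = refl
sumF-const (suc n) c = cong (c +_) (sumF-const n c)

sumF-zero : ∀ n {f : Fin n → ℕ} → (∀ i → f i ≡ 0) → sumF n f ≡ 0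
sumF-zero n f≗0 = trans (sumF-cong n f≗0) (trans (sumF-const n 0) (*-zeroʳ n))

sumF-+ : ∀ n (f g : Fin n → ℕ) → sumF n (λ i → f i + g i) ≡ sumF n f + sumF n g
sumF-+ n f g = begin
  sumF n (λ i → f i + g i)     ≡⟨ sumF≡sum n _ ⟩
  ℕ-Sum.sum (λ i → f i + g i)  ≡⟨ ℕ-Sum.∑-distrib-+ f g ⟩
  ℕ-Sum.sum f + ℕ-Sum.sum g    ≡⟨ cong₂ _+_ (sumF≡sum n f) (sumF≡sum n g) ⟨
  sumF n f + sumF n g          ∎
  where open ≡-Reasoning

sumF-*ʳ : ∀ n (f : Fin n → ℕ) c → sumF n (λ i → f i * c) ≡ sumF n f * c
sumF-*ʳ n f c = begin
  sumF n (λ i → f i * c)     ≡⟨ sumF≡sum n _ ⟩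
  ℕ-Sum.sum (λ i → f i * c)  ≡⟨ ℕ-Sum.*-distribʳ-sum c f ⟨
  ℕ-Sum.sum f * c            ≡⟨ cong (_* c) (sumF≡sum n f) ⟨
  sumF n f * c               ∎
  where open ≡-Reasoning

sumF-comm : ∀ n m (f : Fin n → Fin m → ℕ) →
            sumF n (λ i → sumF m (f i)) ≡ sumF m (λ j → sumF n (λ i → f i j))
sumF-comm n m f = begin
  sumF n (λ i → sumF m (f i))                ≡⟨ sumF≡sum n _ ⟩
  ℕ-Sum.sum (λ i → sumF m (f i))             ≡⟨ ℕ-Sum.sum-cong-≗ (λ i → sumF≡sum m (f i)) ⟩
  ℕ-Sum.sum (λ i → ℕ-Sum.sum (f i))          ≡⟨ ℕ-Sum.∑-comm f ⟩
  ℕ-Sum.sum (λ j → ℕ-Sum.sum (λ i → f i j))  ≡⟨ ℕ-Sum.sum-cong-≗ (λ j → sumF≡sum n (λ i → f i j)) ⟨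
  ℕ-Sum.sum (λ j → sumF n (λ i → f i j))     ≡⟨ sumF≡sum m _ ⟨
  sumF m (λ j → sumF n (λ i → f i j))        ∎
  where open ≡-Reasoning

countF-false : ∀ n {P : Fin n → Bool} → (∀ z → P z ≡ false) → countF n P ≡ 0
countF-false n P≗false = sumF-zero n (cong 𝟙 ∘ P≗false)

countF-≤-𝟙* : ∀ n {P : Fin n → Bool} b {c} → (∀ z → P z ≡ true → b ≡ true) →
              (b ≡ true → countF n P ≤ c) → countF n P ≤ 𝟙 b * c
countF-≤-𝟙* n b P⇒b = ≤-𝟙* b λ b≡false →
  countF-false n λ z → ¬-not λ Pz → contradiction (trans (sym (P⇒b z Pz)) b≡false) λ ()

𝟙-anyF : ∀ n (P : Fin n → Bool) → 𝟙 (anyF n P) ≤ sumF n (𝟙 ∘ P)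
𝟙-anyF zero    P = z≤n
𝟙-anyF (suc n) P = ≤-trans (𝟙-∨ (P zero) _) (+-monoʳ-≤ (𝟙 (P zero)) (𝟙-anyF n (P ∘ suc)))

-- Two separate guards b and c, so that both sides match counted and heavy definitionally.
𝟙-∧∧-anyF-∨ : ∀ n b c (P Q : Fin n → Bool) →
  𝟙 (b ∧ (c ∧ anyF n (λ i → P i ∨ Q i))) ≤ sumF n (λ i → 𝟙 (b ∧ (c ∧ P i)) + 𝟙 (b ∧ (c ∧ Q i)))
𝟙-∧∧-anyF-∨ n true  true  P Q = ≤-trans (𝟙-anyF n _) (sumF-mono n λ i → 𝟙-∨ (P i) (Q i))
𝟙-∧∧-anyF-∨ n true  false P Q = z≤n
𝟙-∧∧-anyF-∨ n false c     P Q = z≤n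

witness : ∀ n (P : Fin n → Bool) → 0 < countF n P → ∃ λ z → P z ≡ true
witness (suc n) P 0<count with P zero in P₀
... | true  = zero , P₀
... | false = let z , Pz = witness n (P ∘ suc) 0<count in suc z , Pz

countF-remove : ∀ n (P : Fin n → Bool) c →
                countF n P ≤ suc (countF n (λ z → P z ∧ not (does (z ≟F c))))
countF-remove (suc n) P zero = begin
  𝟙 (P zero) + countF n (P ∘ suc)
    ≤⟨ +-monoˡ-≤ _ (𝟙≤1 (P zero)) ⟩
  suc (countF n (P ∘ suc))
    ≡⟨ cong suc (sumF-cong n λ z → cong 𝟙 (∧-identityʳ (P (suc z)))) ⟨
  suc (countF n P′)
    ≡⟨ cong (λ b → suc (𝟙 b + countF n P′)) (∧-zeroʳ (P zero)) ⟨
  suc (𝟙 (P zero ∧ false) + countF n P′) ∎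
  where
  open ≤-Reasoning
  P′ : Fin n → Bool
  P′ z = P (suc z) ∧ true
countF-remove (suc n) P (suc c) = begin
  𝟙 (P zero) + countF n (P ∘ suc)
    ≤⟨ +-monoʳ-≤ (𝟙 (P zero)) (countF-remove n (P ∘ suc) c) ⟩
  𝟙 (P zero) + suc (countF n P′)
    ≡⟨ +-suc _ _ ⟩
  suc (𝟙 (P zero) + countF n P′)
    ≡⟨ cong (λ b → suc (𝟙 b + countF n P′)) (∧-identityʳ (P zero)) ⟨
  suc (𝟙 (P zero ∧ true) + countF n P′) ∎
  where
  open ≤-Reasoning
  P′ : Fin n → Bool
  P′ z = P (suc z) ∧ not (does (z ≟F c))

pick-avoiding : ∀ {n} m (P : Fin n → Bool) (ex : Fin m → Fin n) → m < countF n P →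
                ∃ λ z → P z ≡ true × (∀ i → z ≢ ex i)
pick-avoiding {n} zero P ex 0<count = let z , Pz = witness n P 0<count in z , Pz , λ ()
pick-avoiding {n} (suc m) P ex m<count
  with pick-avoiding m (λ z → P z ∧ not (does (z ≟F ex zero))) (ex ∘ suc)
         (s≤s⁻¹ (≤-trans m<count (countF-remove n P (ex zero))))
... | z , Pz , z∉ex = z , ∧-conicalˡ _ _ Pz , λ where
  zero    → does-false⇒ (z ≟F ex zero) (not-injective (∧-conicalʳ (P z) _ Pz))
  (suc i) → z∉ex i

distinct-representatives :
  ∀ {n} r m (ex : Fin m → Fin n) (P : Fin r → Fin n → Bool) → (∀ j → r + m ≤ countF n (P j)) →
  ∃ λ (d : Fin r → Fin n) → (∀ j → P j (d j) ≡ true) × Injective _≡_ _≡_ d × (∀ j i → d j ≢ ex i)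
distinct-representatives zero m ex P wide = (λ ()) , (λ ()) , (λ { {()} }) , λ ()
distinct-representatives (suc r) m ex P wide
  with pick-avoiding m (P zero) ex (≤-trans (s≤s (m≤n+m m r)) (wide zero))
... | z , Pz , z∉ex
  with distinct-representatives r (suc m) (z ∷ ex) (P ∘ suc)
         (λ j → ≤-trans (≤-reflexive (+-suc r m)) (wide (suc j)))
... | d , Pd , d-inj , d∉ = z ∷ d , Pzd , ∷-injective (λ j e → d∉ j zero (sym e)) d-inj , zd∉ex
  where
  Pzd : ∀ j → P j ((z ∷ d) j) ≡ true
  Pzd zero    = Pz
  Pzd (suc j) = Pd j
  zd∉ex : ∀ j i → (z ∷ d) j ≢ ex i
  zd∉ex zero    = z∉ex
  zd∉ex (suc j) = d∉ j ∘ suc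

record HCopy {p q} (s t : ℕ) (E : BipGraph p q) : Set where
  field
    a : Fin s → Fin p
    b : Fin s → Fin q
    c : Fin t → Fin p
    d : Fin t → Fin q
    a-injective : Injective _≡_ _≡_ a
    b-injective : Injective _≡_ _≡_ b
    c-injective : Injective _≡_ _≡_ c
    d-injective : Injective _≡_ _≡_ d
    a≢c : ∀ i j → a i ≢ c j
    b≢d : ∀ i j → b i ≢ d j
    ab-edge : ∀ i → E (a i) (b i) ≡ true
    cd-edge : ∀ j → E (c j) (d j) ≡ true
    ad-edge : ∀ i j → E (a i) (d j) ≡ true
    cb-edge : ∀ i j → E (c j) (b i) ≡ true

HCopy⇒ContainsH : ∀ {p q s t} {E : BipGraph p q} → HCopy s t E → ContainsH s t E
HCopy⇒ContainsH {p} {q} {s} {t} {E} H = f , f-injective , f-edge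
  where
  open HCopy H
  f : HV s t → V p q
  f (HV.a i) = inj₁ (a i)
  f (HV.b i) = inj₂ (b i)
  f (HV.c j) = inj₁ (c j)
  f (HV.d j) = inj₂ (d j)
  f-injective : ∀ x y → f x ≡ f y → x ≡ y
  f-injective (HV.a i) (HV.a j) e = cong HV.a (a-injective (inj₁-injective e))
  f-injective (HV.a i) (HV.c j) e = contradiction (inj₁-injective e) (a≢c i j)
  f-injective (HV.c i) (HV.a j) e = contradiction (sym (inj₁-injective e)) (a≢c j i)
  f-injective (HV.c i) (HV.c j) e = cong HV.c (c-injective (inj₁-injective e))
  f-injective (HV.b i) (HV.b j) e = cong HV.b (b-injective (inj₂-injective e))
  f-injective (HV.b i) (HV.d j) e = contradiction (inj₂-injective e) (b≢d i j)
  f-injective (HV.d i) (HV.b j) e = contradiction (sym (inj₂-injective e)) (b≢d j i)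
  f-injective (HV.d i) (HV.d j) e = cong HV.d (d-injective (inj₂-injective e))
  f-injective (HV.a _) (HV.b _) ()
  f-injective (HV.a _) (HV.d _) ()
  f-injective (HV.b _) (HV.a _) ()
  f-injective (HV.b _) (HV.c _) ()
  f-injective (HV.c _) (HV.b _) ()
  f-injective (HV.c _) (HV.d _) ()
  f-injective (HV.d _) (HV.a _) ()
  f-injective (HV.d _) (HV.c _) ()
  f-edge : ∀ x y → HEdge x y → adj E (f x) (f y) ≡ true
  f-edge _ _ (HEdge.ab i)   = ab-edge i
  f-edge _ _ (HEdge.cd j)   = cd-edge j
  f-edge _ _ (HEdge.ad i j) = ad-edge i j
  f-edge _ _ (HEdge.bc i j) = cb-edge i j

transpose : ∀ {p q} → BipGraph p q → BipGraph q p
transpose E y x = E x y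

-- H_{s,t} is invariant under a_i ↔ b_i, c_j ↔ d_j.
HCopy-transpose : ∀ {p q s t} {E : BipGraph p q} → HCopy s t (transpose E) → HCopy s t E
HCopy-transpose H = record
  { a = b ; b = a ; c = d ; d = c
  ; a-injective = b-injective ; b-injective = a-injective
  ; c-injective = d-injective ; d-injective = c-injective
  ; a≢c = b≢d ; b≢d = a≢c
  ; ab-edge = ab-edge ; cd-edge = cd-edge
  ; ad-edge = cb-edge ; cb-edge = ad-edge }
  where open HCopy H

-- t + s candidates suffice: the d_j must be distinct and avoid the s vertices of b.
HCopy-extend :
  ∀ {p q s t} {E : BipGraph p q} (a : Fin s → Fin p) (b : Fin s → Fin q) (c : Fin t → Fin p)
  (Q : Fin t → Fin q → Bool) →
  Injective _≡_ _≡_ a → Injective _≡_ _≡_ b → Injective _≡_ _≡_ c → (∀ i j → a i ≢ c j) →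
  (∀ i → E (a i) (b i) ≡ true) → (∀ i j → E (c j) (b i) ≡ true) →
  (∀ j → t + s ≤ countF q (Q j)) →
  (∀ j z → Q j z ≡ true → E (c j) z ≡ true × (∀ i → E (a i) z ≡ true)) →
  HCopy s t E
HCopy-extend {s = s} {t} a b c Q a-inj b-inj c-inj a≢c ab cb wide Q⇒adj
  with distinct-representatives t s b Q wide
... | d , Qd , d-inj , d∉b = record
  { a = a ; b = b ; c = c ; d = d
  ; a-injective = a-inj ; b-injective = b-inj ; c-injective = c-inj ; d-injective = d-inj
  ; a≢c = a≢c ; b≢d = λ i j e → d∉b j i (sym e)
  ; ab-edge = ab ; cd-edge = λ j → proj₁ (Q⇒adj j (d j) (Qd j))
  ; ad-edge = λ i j → proj₂ (Q⇒adj j (d j) (Qd j)) i ; cb-edge = cb }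

module _ {l p q} {L : Edges l p q} (canon : canonMatchingB L ≡ true) where

  private
    canon-at : ∀ i j →
      (not (toℕ i <ᵇ toℕ j) ∨ (toℕ (proj₁ (L i)) <ᵇ toℕ (proj₁ (L j))))
      ∧ (does (i ≟F j) ∨ not (does (proj₂ (L i) ≟F proj₂ (L j)))) ≡ true
    canon-at i j = allF-true l (allF-true l canon i) j

  canon-A-monotone : ∀ {i j} → toℕ i < toℕ j → toℕ (proj₁ (L i)) < toℕ (proj₁ (L j))
  canon-A-monotone {i} {j} i<j = <ᵇ⇒< _ _ (Equivalence.from T-≡
    (∨-resolveˡ (∧-conicalˡ _ _ (canon-at i j)) (Equivalence.to T-≡ (<⇒<ᵇ i<j))))

  canon-A-injective : Injective _≡_ _≡_ (proj₁ ∘ L)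
  canon-A-injective {i} {j} e with Finₚ.<-cmp i j
  ... | tri< i<j _ _ = contradiction (canon-A-monotone i<j) (Finₚ.<-irrefl e)
  ... | tri≈ _ i≡j _ = i≡j
  ... | tri> _ _ j<i = contradiction (canon-A-monotone j<i) (Finₚ.<-irrefl (sym e))

  canon-B-injective : Injective _≡_ _≡_ (proj₂ ∘ L)
  canon-B-injective {i} {j} e =
    does-true⇒ (i ≟F j) (∨-resolveʳ (∧-conicalʳ _ _ (canon-at i j)) (dec-true (_ ≟F _) e))

InNᴬ : ∀ {n p q} → BipGraph p q → Edges n p q → Fin p → Set
InNᴬ E M x = (∀ i → E x (proj₂ (M i)) ≡ true) × (∀ i → x ≢ proj₁ (M i))

InNᴮ : ∀ {n p q} → BipGraph p q → Edges n p q → Fin q → Set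
InNᴮ E M y = (∀ i → E (proj₁ (M i)) y ≡ true) × (∀ i → y ≢ proj₂ (M i))

inN⇒InNᴬ : ∀ {k p q} (E : BipGraph p q) (M : Edges (suc k) p q) x →
           inN E M (inj₁ x) ≡ true → InNᴬ E M x
inN⇒InNᴬ {k} E M x x∈N = allF-true (suc k) adjacent , λ i →
  does-false⇒ (x ≟F proj₁ (M i)) (trans (sym (∨-identityʳ _)) (outside i))
  where
  x∈N′ : inCommonNbr E (BM M) (inj₁ x) ∧ not (inVM M (inj₁ x)) ≡ true
  x∈N′ = trans (sym (∨-identityʳ _)) x∈N
  adjacent : inCommonNbr E (BM M) (inj₁ x) ≡ true
  adjacent = ∧-conicalˡ _ _ x∈N′
  outside : ∀ i → (inj₁ x ≡ᵛ AM M i) ∨ (inj₁ x ≡ᵛ BM M i) ≡ false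
  outside = anyF-false (suc k) (not-injective (∧-conicalʳ _ _ x∈N′))

inN⇒InNᴮ : ∀ {k p q} (E : BipGraph p q) (M : Edges (suc k) p q) y →
           inN E M (inj₂ y) ≡ true → InNᴮ E M y
inN⇒InNᴮ {k} E M y y∈N = allF-true (suc k) adjacent , λ i →
  does-false⇒ (y ≟F proj₂ (M i)) (outside i)
  where
  adjacent : inCommonNbr E (AM M) (inj₂ y) ≡ true
  adjacent = ∧-conicalˡ _ _ y∈N
  outside : ∀ i → (inj₂ y ≡ᵛ AM M i) ∨ (inj₂ y ≡ᵛ BM M i) ≡ false
  outside = anyF-false (suc k) (not-injective (∧-conicalʳ _ _ y∈N))

simB⇒⊆N : ∀ {k l p q} (E : BipGraph p q) (M : Edges (suc k) p q) (L : Edges l p q) →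
          simB E M L ≡ true → ∀ r →
          E (proj₁ (L r)) (proj₂ (L r)) ≡ true × InNᴬ E M (proj₁ (L r)) × InNᴮ E M (proj₂ (L r))
simB⇒⊆N {l = l} {p} {q} E M L M∼L r =
  ∧-conicalˡ (E x y) _ Lr
  , inN⇒InNᴬ E M x (∧-conicalˡ _ _ ends)
  , inN⇒InNᴮ E M y (∧-conicalʳ (inN E M (inj₁ x)) _ ends)
  where
  x : Fin p
  x = proj₁ (L r)
  y : Fin q
  y = proj₂ (L r)
  Lr : E x y ∧ inN E M (inj₁ x) ∧ inN E M (inj₂ y) ≡ true
  Lr = allF-true l M∼L r
  ends : inN E M (inj₁ x) ∧ inN E M (inj₂ y) ≡ true
  ends = ∧-conicalʳ (E x y) _ Lr

simB-∷⇒ : ∀ {k l p q} (E : BipGraph p q) (M : Edges (suc k) p q) {x y} (L : Edges l p q) →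
          simB E M ((x , y) ∷ L) ≡ true →
          inN E M (inj₁ x) ≡ true × inN E M (inj₂ y) ≡ true × simB E M L ≡ true
simB-∷⇒ E M {x} {y} L M∼xyL =
  ∧-conicalˡ _ _ ends , ∧-conicalʳ (inN E M (inj₁ x)) _ ends , ∧-conicalʳ _ _ M∼xyL
  where
  ends : inN E M (inj₁ x) ∧ inN E M (inj₂ y) ≡ true
  ends = ∧-conicalʳ (E x y) _ (∧-conicalˡ _ _ M∼xyL)

degN-inj₁-≤ : ∀ {l p q} (E : BipGraph p q) (L : Edges l p q) v →
              degN E L (inj₁ v) ≤ countF q (λ z → inN E L (inj₂ z) ∧ E v z)
degN-inj₁-≤ {p = p} {q} E L v =
  ≤-trans (if-then-0-≤ (inN E L (inj₁ v)) _)
          (≤-reflexive (cong (_+ countF q (λ z → inN E L (inj₂ z) ∧ E v z))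
                                 (countF-false p λ x → ∧-zeroʳ (inN E L (inj₁ x)))))

degN-inj₂-≤ : ∀ {l p q} (E : BipGraph p q) (L : Edges l p q) w →
              degN E L (inj₂ w) ≤ countF p (λ z → inN E L (inj₁ z) ∧ E z w)
degN-inj₂-≤ {p = p} {q} E L w =
  ≤-trans (if-then-0-≤ (inN E L (inj₂ w)) _)
          (≤-reflexive (trans (cong (countF p (λ z → inN E L (inj₁ z) ∧ E z w) +_)
                                    (countF-false q λ y → ∧-zeroʳ (inN E L (inj₂ y))))
                              (+-identityʳ _)))

-- The hypotheses describe t matchings (c_j y) + L′ of N(M) in each of which a_i = proj₁ (M i)
-- has at least 2t neighbours (those z with Q j z).
fan⇒HCopy :
  ∀ {p q n t} {E : BipGraph p q} (M : Edges n p q) (i : Fin n) (y : Fin q) (L′ : Edges n p q)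
  (c : Fin t → Fin p) (Q : Fin t → Fin q → Bool) → suc n ≤ t →
  Injective _≡_ _≡_ (proj₂ ∘ M) → InNᴮ E M y →
  (∀ r → InNᴬ E M (proj₁ (L′ r))) → Injective _≡_ _≡_ (proj₁ ∘ L′) →
  Injective _≡_ _≡_ c → (∀ j → InNᴬ E M (c j)) → (∀ j → E (c j) y ≡ true) →
  (∀ j r → c j ≢ proj₁ (L′ r)) →
  (∀ j → 2 * t ≤ countF q (Q j)) →
  (∀ j z → Q j z ≡ true →
     E (proj₁ (M i)) z ≡ true × E (c j) z ≡ true × (∀ r → E (proj₁ (L′ r)) z ≡ true)) →
  HCopy (suc n) t E
fan⇒HCopy {p} {q} {n} {t} {E} M i y L′ c Q s≤t bM-inj y∈N L′∈N L′-inj c-inj c∈N cy-edge c∉L′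
  wide Q⇒adj =
  HCopy-extend a b c Q
    (∷-injective (λ r e → proj₂ (L′∈N r) i (sym e)) L′-inj)
    (∷-injective (proj₂ y∈N) bM-inj)
    c-inj a≢c ab-edge cb-edge
    (λ j → ≤-trans t+s≤2t (wide j))
    λ j z Qz → let vz , cz , L′z = Q⇒adj j z Qz in cz , λ where
      zero    → vz
      (suc r) → L′z r
  where
  a : Fin (suc n) → Fin p
  a = proj₁ (M i) ∷ (proj₁ ∘ L′)
  b : Fin (suc n) → Fin q
  b = y ∷ (proj₂ ∘ M)
  a≢c : ∀ r j → a r ≢ c j
  a≢c zero    j e = proj₂ (c∈N j) i (sym e)
  a≢c (suc r) j e = c∉L′ j r (sym e)
  ab-edge : ∀ r → E (a r) (b r) ≡ true
  ab-edge zero    = proj₁ y∈N i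
  ab-edge (suc r) = proj₁ (L′∈N r) r
  cb-edge : ∀ r j → E (c j) (b r) ≡ true
  cb-edge zero    j = cy-edge j
  cb-edge (suc r) j = proj₁ (c∈N j) r
  t+s≤2t : t + suc n ≤ 2 * t
  t+s≤2t = ≤-trans (+-monoʳ-≤ t s≤t) (≤-reflexive (cong (t +_) (sym (+-identityʳ t))))

module _ {p q : ℕ} where

  sumEdges : ∀ l → (Edges l p q → ℕ) → ℕ
  sumEdges zero    f = f (λ ())
  sumEdges (suc l) f = sumF p λ x → sumF q λ y → sumEdges l (f ∘ ((x , y) ∷_))

  countEdges≡sumEdges : ∀ l (P : Edges l p q → Bool) → countEdges l P ≡ sumEdges l (𝟙 ∘ P)
  countEdges≡sumEdges zero    P = refl
  countEdges≡sumEdges (suc l) P =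
    sumF-cong p λ x → sumF-cong q λ y → countEdges≡sumEdges l _

  sumEdges-mono : ∀ l {f g : Edges l p q → ℕ} → (∀ L → f L ≤ g L) → sumEdges l f ≤ sumEdges l g
  sumEdges-mono zero    f≤g = f≤g _
  sumEdges-mono (suc l) f≤g =
    sumF-mono p λ x → sumF-mono q λ y → sumEdges-mono l (f≤g ∘ ((x , y) ∷_))

  sumEdges-*ʳ : ∀ l (f : Edges l p q → ℕ) c → sumEdges l (λ L → f L * c) ≡ sumEdges l f * c
  sumEdges-*ʳ zero    f c = refl
  sumEdges-*ʳ (suc l) f c = begin
    sumF p (λ x → sumF q λ y → sumEdges l λ L → f ((x , y) ∷ L) * c)
      ≡⟨ sumF-cong p (λ x → sumF-cong q λ y → sumEdges-*ʳ l _ c) ⟩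
    sumF p (λ x → sumF q λ y → sumEdges l (f ∘ ((x , y) ∷_)) * c)
      ≡⟨ sumF-cong p (λ x → sumF-*ʳ q _ c) ⟩
    sumF p (λ x → sumF q (λ y → sumEdges l (f ∘ ((x , y) ∷_))) * c)
      ≡⟨ sumF-*ʳ p _ c ⟩
    sumEdges (suc l) f * c ∎
    where open ≡-Reasoning

  sumF-sumEdges-comm : ∀ l n (F : Fin n → Edges l p q → ℕ) →
                       sumF n (λ z → sumEdges l (F z)) ≡ sumEdges l (λ L → sumF n (λ z → F z L))
  sumF-sumEdges-comm zero    n F = refl
  sumF-sumEdges-comm (suc l) n F = begin
    sumF n (λ z → sumF p λ x → sumF q λ y → sumEdges l (F z ∘ ((x , y) ∷_)))
      ≡⟨ sumF-comm n p _ ⟩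
    sumF p (λ x → sumF n λ z → sumF q λ y → sumEdges l (F z ∘ ((x , y) ∷_)))
      ≡⟨ sumF-cong p (λ x → sumF-comm n q _) ⟩
    sumF p (λ x → sumF q λ y → sumF n λ z → sumEdges l (F z ∘ ((x , y) ∷_)))
      ≡⟨ sumF-cong p (λ x → sumF-cong q λ y → sumF-sumEdges-comm l n _) ⟩
    sumEdges (suc l) (λ L → sumF n (λ z → F z L)) ∎
    where open ≡-Reasoning

  countEdges-suc : ∀ l (P : Edges (suc l) p q → Bool) →
    countEdges (suc l) P ≡ sumEdges l (λ L → sumF p λ x → sumF q λ y → 𝟙 (P ((x , y) ∷ L)))
  countEdges-suc l P = begin
    sumF p (λ x → sumF q λ y → countEdges l (P ∘ ((x , y) ∷_)))
      ≡⟨ sumF-cong p (λ x → sumF-cong q λ y → countEdges≡sumEdges l _) ⟩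
    sumF p (λ x → sumF q λ y → sumEdges l (𝟙 ∘ P ∘ ((x , y) ∷_)))
      ≡⟨ sumF-cong p (λ x → sumF-sumEdges-comm l q _) ⟩
    sumF p (λ x → sumEdges l λ L → sumF q λ y → 𝟙 (P ((x , y) ∷ L)))
      ≡⟨ sumF-sumEdges-comm l p _ ⟩
    sumEdges l (λ L → sumF p λ x → sumF q λ y → 𝟙 (P ((x , y) ∷ L))) ∎
    where open ≡-Reasoning

  countEdges-false : ∀ l → countEdges {p} {q} l (λ _ → false) ≡ 0
  countEdges-false zero    = refl
  countEdges-false (suc l) = sumF-zero p λ x → sumF-zero q λ y → countEdges-false l

  countEdges-all : ∀ l (g : Fin p → Fin q → Bool) →
    countEdges l (λ L → allF l (λ i → g (proj₁ (L i)) (proj₂ (L i))))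
      ≡ sumF p (λ x → countF q (g x)) ^ l
  countEdges-all zero    g = refl
  countEdges-all (suc l) g = begin
    sumF p (λ x → sumF q λ y → countEdges l (λ L → g x y ∧ all L))
      ≡⟨ sumF-cong p (λ x → sumF-cong q λ y → countEdges-∧ (g x y)) ⟩
    sumF p (λ x → sumF q λ y → 𝟙 (g x y) * countEdges l all)
      ≡⟨ sumF-cong p (λ x → sumF-*ʳ q _ _) ⟩
    sumF p (λ x → countF q (g x) * countEdges l all)
      ≡⟨ sumF-*ʳ p _ _ ⟩
    sumF p (λ x → countF q (g x)) * countEdges l all
      ≡⟨ cong (sumF p (λ x → countF q (g x)) *_) (countEdges-all l g) ⟩
    sumF p (λ x → countF q (g x)) * sumF p (λ x → countF q (g x)) ^ l ∎
    where
    open ≡-Reasoning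
    all : Edges l p q → Bool
    all L = allF l (λ i → g (proj₁ (L i)) (proj₂ (L i)))
    countEdges-∧ : ∀ b → countEdges l (λ L → b ∧ all L) ≡ 𝟙 b * countEdges l all
    countEdges-∧ true  = sym (+-identityʳ _)
    countEdges-∧ false = countEdges-false l

module Correlated {p q : ℕ} (E : BipGraph p q) (k t : ℕ) (s≤t : suc (suc k) ≤ t)
                  (H-free : HFree (suc (suc k)) t E)
                  (M : Edges (suc k) p q) (M-matching : IsMatching E M) where

  heavy : Edges (suc (suc k)) p q → V p q → Bool
  heavy L u = canonMatchingB L ∧ (simB E M L ∧ (2 * t ≤ᵇ degN E L u))

  module _ (L : Edges (suc (suc k)) p q) (u : V p q) (L-heavy : heavy L u ≡ true) where

    heavy⇒canon : canonMatchingB L ≡ true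
    heavy⇒canon = ∧-conicalˡ _ _ L-heavy

    heavy⇒simB : simB E M L ≡ true
    heavy⇒simB = ∧-conicalˡ _ _ (∧-conicalʳ (canonMatchingB L) _ L-heavy)

    heavy⇒degree : 2 * t ≤ degN E L u
    heavy⇒degree = ≤ᵇ⇒≤ _ _ (Equivalence.from T-≡
      (∧-conicalʳ (simB E M L) _ (∧-conicalʳ (canonMatchingB L) _ L-heavy)))

  j₀ : Fin t
  j₀ = fromℕ< (≤-trans (s≤s z≤n) s≤t)

  heavy-fanᴬ : ∀ L′ i y → inN E M (inj₂ y) ≡ true → (c : Fin t → Fin p) → Injective _≡_ _≡_ c →
               (∀ j → heavy ((c j , y) ∷ L′) (AM M i) ≡ true) → HCopy (suc (suc k)) t E
  heavy-fanᴬ L′ i y y∈N c c-inj c-heavy =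
    fan⇒HCopy M i y L′ c Q s≤t (λ {r} {r′} → proj₂ (proj₂ M-matching) r r′) (inN⇒InNᴮ E M y y∈N)
      (λ r → proj₁ (proj₂ (L⊆N j₀ (suc r))))
      (λ {r} {r′} e → Finₚ.suc-injective (L-injective j₀ {suc r} {suc r′} e))
      c-inj
      (λ j → proj₁ (proj₂ (L⊆N j zero)))
      (λ j → proj₁ (L⊆N j zero))
      (λ j r e → contradiction (L-injective j {zero} {suc r} e) λ ())
      (λ j → ≤-trans (heavy⇒degree (L j) (AM M i) (c-heavy j)) (degN-inj₁-≤ E (L j) _))
      Q⇒adj
    where
    L : Fin t → Edges (suc (suc k)) p q
    L j = (c j , y) ∷ L′
    L⊆N : ∀ j r → E (proj₁ (L j r)) (proj₂ (L j r)) ≡ true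
                  × InNᴬ E M (proj₁ (L j r)) × InNᴮ E M (proj₂ (L j r))
    L⊆N j = simB⇒⊆N E M (L j) (heavy⇒simB (L j) (AM M i) (c-heavy j))
    L-injective : ∀ j → Injective _≡_ _≡_ (proj₁ ∘ L j)
    L-injective j = canon-A-injective {L = L j} (heavy⇒canon (L j) (AM M i) (c-heavy j))
    Q : Fin t → Fin q → Bool
    Q j z = inN E (L j) (inj₂ z) ∧ E (proj₁ (M i)) z
    Q⇒adj : ∀ j z → Q j z ≡ true →
            E (proj₁ (M i)) z ≡ true × E (c j) z ≡ true × (∀ r → E (proj₁ (L′ r)) z ≡ true)
    Q⇒adj j z Qz = ∧-conicalʳ _ _ Qz , z∼L zero , z∼L ∘ suc
      where
      z∼L : ∀ r → E (proj₁ (L j r)) z ≡ true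
      z∼L = proj₁ (inN⇒InNᴮ E (L j) z (∧-conicalˡ _ _ Qz))

  heavy-fanᴮ : ∀ L′ i x → inN E M (inj₁ x) ≡ true → (c : Fin t → Fin q) → Injective _≡_ _≡_ c →
               (∀ j → heavy ((x , c j) ∷ L′) (BM M i) ≡ true) → HCopy (suc (suc k)) t E
  heavy-fanᴮ L′ i x x∈N c c-inj c-heavy = HCopy-transpose
    (fan⇒HCopy {E = transpose E} (swap ∘ M) i x (swap ∘ L′) c Q s≤t
      (λ {r} {r′} → proj₁ (proj₂ M-matching) r r′) (inN⇒InNᴬ E M x x∈N)
      (λ r → proj₂ (proj₂ (L⊆N j₀ (suc r))))
      (λ {r} {r′} e → Finₚ.suc-injective (L-injective j₀ {suc r} {suc r′} e))
      c-inj
      (λ j → proj₂ (proj₂ (L⊆N j zero)))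
      (λ j → proj₁ (L⊆N j zero))
      (λ j r e → contradiction (L-injective j {zero} {suc r} e) λ ())
      (λ j → ≤-trans (heavy⇒degree (L j) (BM M i) (c-heavy j)) (degN-inj₂-≤ E (L j) _))
      Q⇒adj)
    where
    L : Fin t → Edges (suc (suc k)) p q
    L j = (x , c j) ∷ L′
    L⊆N : ∀ j r → E (proj₁ (L j r)) (proj₂ (L j r)) ≡ true
                  × InNᴬ E M (proj₁ (L j r)) × InNᴮ E M (proj₂ (L j r))
    L⊆N j = simB⇒⊆N E M (L j) (heavy⇒simB (L j) (BM M i) (c-heavy j))
    L-injective : ∀ j → Injective _≡_ _≡_ (proj₂ ∘ L j)
    L-injective j = canon-B-injective {L = L j} (heavy⇒canon (L j) (BM M i) (c-heavy j))
    Q : Fin t → Fin p → Bool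
    Q j z = inN E (L j) (inj₁ z) ∧ E z (proj₂ (M i))
    Q⇒adj : ∀ j z → Q j z ≡ true →
            E z (proj₂ (M i)) ≡ true × E z (c j) ≡ true × (∀ r → E z (proj₂ (L′ r)) ≡ true)
    Q⇒adj j z Qz = ∧-conicalʳ _ _ Qz , z∼L zero , z∼L ∘ suc
      where
      z∼L : ∀ r → E z (proj₂ (L j r)) ≡ true
      z∼L = proj₁ (inN⇒InNᴬ E (L j) z (∧-conicalˡ _ _ Qz))

  few-heavyᴬ : ∀ L′ i y → inN E M (inj₂ y) ≡ true →
               countF p (λ x → heavy ((x , y) ∷ L′) (AM M i)) < t
  few-heavyᴬ L′ i y y∈N = ≰⇒> λ t≤count →
    let c , c-heavy , c-inj , _ = distinct-representatives t 0 (λ ())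
                                    (λ _ x → heavy ((x , y) ∷ L′) (AM M i))
                                    (λ _ → ≤-trans (≤-reflexive (+-identityʳ t)) t≤count)
    in H-free (HCopy⇒ContainsH (heavy-fanᴬ L′ i y y∈N c c-inj c-heavy))

  few-heavyᴮ : ∀ L′ i x → inN E M (inj₁ x) ≡ true →
               countF q (λ y → heavy ((x , y) ∷ L′) (BM M i)) < t
  few-heavyᴮ L′ i x x∈N = ≰⇒> λ t≤count →
    let c , c-heavy , c-inj , _ = distinct-representatives t 0 (λ ())
                                    (λ _ y → heavy ((x , y) ∷ L′) (BM M i))
                                    (λ _ → ≤-trans (≤-reflexive (+-identityʳ t)) t≤count)
    in H-free (HCopy⇒ContainsH (heavy-fanᴮ L′ i x x∈N c c-inj c-heavy))

  heavy-countᴬ : ∀ L′ i y →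
    countF p (λ x → heavy ((x , y) ∷ L′) (AM M i)) ≤ 𝟙 (inN E M (inj₂ y)) * (t ∸ 1)
  heavy-countᴬ L′ i y = countF-≤-𝟙* p _
    (λ x h → proj₁ (proj₂ (simB-∷⇒ E M L′ (heavy⇒simB ((x , y) ∷ L′) (AM M i) h))))
    (suc[m]≤n⇒m≤pred[n] ∘ few-heavyᴬ L′ i y)

  heavy-countᴮ : ∀ L′ i x →
    countF q (λ y → heavy ((x , y) ∷ L′) (BM M i)) ≤ 𝟙 (inN E M (inj₁ x)) * (t ∸ 1)
  heavy-countᴮ L′ i x = countF-≤-𝟙* q _
    (λ y h → proj₁ (simB-∷⇒ E M L′ (heavy⇒simB ((x , y) ∷ L′) (BM M i) h)))
    (suc[m]≤n⇒m≤pred[n] ∘ few-heavyᴮ L′ i x)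

  heavyᴬᴮ : Edges (suc (suc k)) p q → Fin (suc k) → ℕ
  heavyᴬᴮ L i = 𝟙 (heavy L (AM M i)) + 𝟙 (heavy L (BM M i))

  heavy-pairs : ∀ L′ i → sumF p (λ x → sumF q λ y → heavyᴬᴮ ((x , y) ∷ L′) i) ≤ vN E M * (t ∸ 1)
  heavy-pairs L′ i = begin
    sumF p (λ x → sumF q λ y → hᴬ x y + hᴮ x y)
      ≡⟨ sumF-cong p (λ x → sumF-+ q (hᴬ x) (hᴮ x)) ⟩
    sumF p (λ x → sumF q (hᴬ x) + sumF q (hᴮ x))
      ≡⟨ sumF-+ p _ _ ⟩
    sumF p (λ x → sumF q (hᴬ x)) + sumF p (λ x → sumF q (hᴮ x))
      ≡⟨ cong (_+ sumF p (λ x → sumF q (hᴮ x))) (sumF-comm p q hᴬ) ⟩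
    sumF q (λ y → sumF p (λ x → hᴬ x y)) + sumF p (λ x → sumF q (hᴮ x))
      ≤⟨ +-mono-≤ (sumF-mono q (heavy-countᴬ L′ i)) (sumF-mono p (heavy-countᴮ L′ i)) ⟩
    sumF q (λ y → 𝟙 (inN E M (inj₂ y)) * (t ∸ 1)) + sumF p (λ x → 𝟙 (inN E M (inj₁ x)) * (t ∸ 1))
      ≡⟨ cong₂ _+_ (sumF-*ʳ q _ (t ∸ 1)) (sumF-*ʳ p _ (t ∸ 1)) ⟩
    vᴮ * (t ∸ 1) + vᴬ * (t ∸ 1)
      ≡⟨ +-comm (vᴮ * (t ∸ 1)) _ ⟩
    vᴬ * (t ∸ 1) + vᴮ * (t ∸ 1)
      ≡⟨ *-distribʳ-+ (t ∸ 1) vᴬ vᴮ ⟨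
    vN E M * (t ∸ 1) ∎
    where
    open ≤-Reasoning
    hᴬ hᴮ : Fin p → Fin q → ℕ
    hᴬ x y = 𝟙 (heavy ((x , y) ∷ L′) (AM M i))
    hᴮ x y = 𝟙 (heavy ((x , y) ∷ L′) (BM M i))
    vᴬ vᴮ : ℕ
    vᴬ = countF p (λ x → inN E M (inj₁ x))
    vᴮ = countF q (λ y → inN E M (inj₂ y))

  counted : Edges (suc (suc k)) p q → Bool
  counted L = canonMatchingB L ∧ correlated E (2 * t) M L

  counted≤heavy : ∀ L → 𝟙 (counted L) ≤ sumF (suc k) (heavyᴬᴮ L)
  counted≤heavy L = 𝟙-∧∧-anyF-∨ (suc k) (canonMatchingB L) (simB E M L)
    (λ i → 2 * t ≤ᵇ degN E L (AM M i)) (λ i → 2 * t ≤ᵇ degN E L (BM M i))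

  counted⇒M∼tail : ∀ {x y} L′ → counted ((x , y) ∷ L′) ≡ true → simB E M L′ ≡ true
  counted⇒M∼tail {x} {y} L′ h =
    proj₂ (proj₂ (simB-∷⇒ E M L′ (∧-conicalˡ _ _ (∧-conicalʳ (canonMatchingB ((x , y) ∷ L′)) _ h))))

  counted-extensions : ∀ L′ → sumF p (λ x → sumF q λ y → 𝟙 (counted ((x , y) ∷ L′)))
                                ≤ 𝟙 (simB E M L′) * (suc k * (vN E M * (t ∸ 1)))
  counted-extensions L′ = ≤-𝟙* (simB E M L′)
    (λ M≁L′ → sumF-zero p λ x → countF-false q λ y → ¬-not λ h →
       contradiction (trans (sym (counted⇒M∼tail L′ h)) M≁L′) λ ())
    λ _ → begin
      sumF p (λ x → sumF q λ y → 𝟙 (counted ((x , y) ∷ L′)))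
        ≤⟨ sumF-mono p (λ x → sumF-mono q λ y → counted≤heavy ((x , y) ∷ L′)) ⟩
      sumF p (λ x → sumF q λ y → sumF (suc k) (heavyᴬᴮ ((x , y) ∷ L′)))
        ≡⟨ sumF-cong p (λ x → sumF-comm q (suc k) λ y → heavyᴬᴮ ((x , y) ∷ L′)) ⟩
      sumF p (λ x → sumF (suc k) λ i → sumF q λ y → heavyᴬᴮ ((x , y) ∷ L′) i)
        ≡⟨ sumF-comm p (suc k) (λ x i → sumF q λ y → heavyᴬᴮ ((x , y) ∷ L′) i) ⟩
      sumF (suc k) (λ i → sumF p λ x → sumF q λ y → heavyᴬᴮ ((x , y) ∷ L′) i)
        ≤⟨ sumF-mono (suc k) (heavy-pairs L′) ⟩
      sumF (suc k) (λ _ → vN E M * (t ∸ 1))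
        ≡⟨ sumF-const (suc k) _ ⟩
      suc k * (vN E M * (t ∸ 1)) ∎
    where open ≤-Reasoning

  count-bound : numCorrelated E (suc (suc k)) (2 * t) M
                  ≤ suc k * (t ∸ 1) * (eN E M ^ suc k) * vN E M
  count-bound = begin
    countEdges (suc (suc k)) counted
      ≡⟨ countEdges-suc (suc k) counted ⟩
    sumEdges (suc k) (λ L′ → sumF p λ x → sumF q λ y → 𝟙 (counted ((x , y) ∷ L′)))
      ≤⟨ sumEdges-mono (suc k) counted-extensions ⟩
    sumEdges (suc k) (λ L′ → 𝟙 (simB E M L′) * K)
      ≡⟨ sumEdges-*ʳ (suc k) (𝟙 ∘ simB E M) K ⟩
    sumEdges (suc k) (𝟙 ∘ simB E M) * K
      ≡⟨ cong (_* K) (countEdges≡sumEdges (suc k) (simB E M)) ⟨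
    countEdges (suc k) (simB E M) * K
      ≡⟨ cong (_* K) (countEdges-all (suc k) λ x y → E x y ∧ inN E M (inj₁ x) ∧ inN E M (inj₂ y)) ⟩
    eN E M ^ suc k * K
      ≡⟨ rearrange (eN E M ^ suc k) (suc k) (vN E M) (t ∸ 1) ⟩
    suc k * (t ∸ 1) * (eN E M ^ suc k) * vN E M ∎
    where
    open ≤-Reasoning
    open +-*-Solver
    K : ℕ
    K = suc k * (vN E M * (t ∸ 1))
    rearrange : ∀ e s v u → e * (s * (v * u)) ≡ s * u * e * v
    rearrange = solve 4 (λ e s v u → e :* (s :* (v :* u)) := s :* u :* e :* v) refl

lemma3p1 : (s t : ℕ) → 2 ≤ s → s ≤ t → (p q : ℕ) → (E : BipGraph p q) →
    HFree s t E → (M : Edges (s ∸ 1) p q) → IsMatching E M →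
    numCorrelated E s (2 * t) M
      ≤ (s ∸ 1) * (t ∸ 1) * (eN E M ^ (s ∸ 1)) * vN E M
lemma3p1 (suc (suc k)) t (s≤s (s≤s _)) s≤t p q E H-free M M-matching =
  Correlated.count-bound E k t s≤t H-free M M-matching
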